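{- Let $n,k,r$ be positive integers with $r\geq 2$ and $n\geq rk$. The chromatic number of $\mathrm{IG}_{n,k}^{(r)}$ is equal to $\lceil n/k\rceil$.
   Context: Write $[n]=\{1,\ldots,n\}$ and view its elements as placed in clockwise order on a circle; a $k$-subset of $[n]$ is called a $k$-polygon. A $k$-polygon $P$ is $r$-stable if the cyclic distance (on $\mathbb{Z}/n\mathbb{Z}$) between any two distinct points of $P$ is at least $r$. Two $k$-polygons $P=\{p_1<\cdots<p_k\}$ and $Q=\{q_1<\cdots<q_k\}$ interlace if either $p_1<q_1<p_2<q_2<\cdots<p_k<q_k$ or $q_1<p_1<q_2<p_2<\cdots<q_k<p_k$. The graph $\mathrm{IG}_{n,k}^{(r)}$ has as vertices the $r$-stable $k$-polygons on $[n]$, two being adjacent iff they interlace. -}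

module Defs where

open import Data.Nat using (ℕ; zero; suc; _+_; _*_; _∸_; _≤_; _<_; _⊓_; ∣_-_∣; NonZero)
open import Data.Nat.DivMod using (_/_)
open import Data.Fin using (Fin; toℕ)
open import Data.Product using (_×_)
open import Relation.Binary.PropositionalEquality using (_≡_; _≢_)

⌈_/_⌉ : ℕ → (k : ℕ) → .{{NonZero k}} → ℕ
⌈ n / k ⌉ = (n + (k ∸ 1)) / k

cdist : ℕ → ℕ → ℕ → ℕ
cdist n a b = ∣ a - b ∣ ⊓ (n ∸ ∣ a - b ∣)

-- A k-polygon on [n], represented by its elements listed in increasing order
-- p 0 < p 1 < ... < p (k-1), all in {1,…,n}.
record IsPolygon (n k : ℕ) (p : Fin k → ℕ) : Set where
  field
    inRange : ∀ i → 1 ≤ p i × p i ≤ n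
    increasing : ∀ i j → toℕ i < toℕ j → p i < p j

IsStable : (n k r : ℕ) → (Fin k → ℕ) → Set
IsStable n k r p = ∀ i j → i ≢ j → r ≤ cdist n (p i) (p j)

IsVertex : (n k r : ℕ) → (Fin k → ℕ) → Set
IsVertex n k r p = IsPolygon n k p × IsStable n k r p

InterlaceFrom : (k : ℕ) → (Fin k → ℕ) → (Fin k → ℕ) → Set
InterlaceFrom k p q =
  (∀ i → p i < q i) × (∀ i j → toℕ j ≡ suc (toℕ i) → q i < p j)

Interlace : (k : ℕ) → (Fin k → ℕ) → (Fin k → ℕ) → Set
Interlace k p q = InterlaceFrom k p q Data.Sum.⊎ InterlaceFrom k q p
  where import Data.Sum

ProperColouring : (n k r c : ℕ) → Set
ProperColouring n k r c =
  Data.Product.Σ ((p : Fin k → ℕ) → IsVertex n k r p → Fin c) λ col →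
    ∀ p q (hp : IsVertex n k r p) (hq : IsVertex n k r q) →
      Interlace k p q → col p hp ≢ col q hq
  where import Data.Product

ChromaticNumberIs : (n k r m : ℕ) → Set
ChromaticNumberIs n k r m =
  ProperColouring n k r m × (∀ c → ProperColouring n k r c → m ≤ c)

{-# OPTIONS --safe #-}
module Submission where

-- Colour an r-stable k-polygon p by the block ⌊(Σ p mod n)/k⌋ of length k containing its point
-- sum modulo n.  If p and q interlace then k ≤ Σ q − Σ p ≤ n − k, so the two point sums lie at
-- cyclic distance at least k in ℤ/nℤ and fall into different blocks: ⌈n/k⌉ colours suffice.
-- Conversely, for j < n the k-polygons T_j = {1 + ⌊(j + i n)/k⌋ : i < k} are r-stable because
-- r k ≤ n, and T_j, T_j' interlace whenever j and j' are at cyclic distance at least k.  So every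
-- proper colouring of the graph colours the circular clique on ℤ/nℤ, in which, as 2k ≤ n, a
-- colour class has at most k elements; hence n ≤ c k.

open import Defs
open import Data.Empty using (⊥-elim)
open import Data.Fin using (Fin; toℕ; zero; suc; fromℕ<; fromℕ; inject₁; combine; _≟_)
open import Data.Fin.Properties
  using (toℕ-injective; toℕ<n; toℕ-inject₁; fromℕ<-injective; combine-injective; injective⇒≤)
open import Data.Nat using (ℕ; zero; suc; _+_; _*_; _∸_; _≤_; _<_; _⊓_; NonZero; >-nonZero⁻¹; z≤n; s≤s; s≤s⁻¹; _<?_)
open import Data.Nat.DivMod
open import Data.Nat.Divisibility using (divides)
open import Data.Nat.Properties hiding (_≟_)
open import Data.Product using (_×_; _,_; Σ; proj₁; proj₂)
open import Data.Sum using (_⊎_; inj₁; inj₂)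
open import Function using (_∘_)
open import Relation.Binary.Definitions using (tri<; tri≈; tri>)
open import Relation.Binary.PropositionalEquality
open import Relation.Nullary using (¬_; Dec; yes; no)

open import Algebra.Properties.CommutativeSemigroup +-commutativeSemigroup using (xy∙z≈xz∙y; x∙yz≈yx∙z)
open import Algebra.Properties.Monoid.Sum +-0-monoid using (sum; sum-init-last)

[m+o*n]/n≡m/n+o : ∀ m o n .{{_ : NonZero n}} → (m + o * n) / n ≡ m / n + o
[m+o*n]/n≡m/n+o m o n = trans (+-distrib-/-∣ʳ m (divides o refl)) (cong (m / n +_) (m*n/n≡m o n))

m+o*n≤p⇒m/n+o≤p/n : ∀ {m p} o n .{{_ : NonZero n}} → m + o * n ≤ p → m / n + o ≤ p / n
m+o*n≤p⇒m/n+o≤p/n {m} {p} o n le = subst (_≤ p / n) ([m+o*n]/n≡m/n+o m o n) (/-monoˡ-≤ n le)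

m+n≤o⇒m/n<o/n : ∀ {m o} n .{{_ : NonZero n}} → m + n ≤ o → m / n < o / n
m+n≤o⇒m/n<o/n {m} {o} n le = subst (_≤ o / n) (+-comm (m / n) 1)
  (m+o*n≤p⇒m/n+o≤p/n 1 n (subst (λ t → m + t ≤ o) (sym (*-identityˡ n)) le))

m+n≡1+m+[n∸1] : ∀ m n .{{_ : NonZero n}} → m + n ≡ suc m + (n ∸ 1)
m+n≡1+m+[n∸1] m (suc n) = +-suc m n

m<n⇒m/k<⌈n/k⌉ : ∀ {m n} k .{{_ : NonZero k}} → m < n → m / k < ⌈ n / k ⌉
m<n⇒m/k<⌈n/k⌉ {m} {n} k m<n =
  m+n≤o⇒m/n<o/n k (subst (_≤ n + (k ∸ 1)) (sym (m+n≡1+m+[n∸1] m k)) (+-monoˡ-≤ (k ∸ 1) m<n))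

n≤c*k⇒⌈n/k⌉≤c : ∀ {n c} k .{{_ : NonZero k}} → n ≤ c * k → ⌈ n / k ⌉ ≤ c
n≤c*k⇒⌈n/k⌉≤c {n} {c} k n≤c*k = s≤s⁻¹ (m<n*o⇒m/o<n (begin-strict
  n + (k ∸ 1)     ≤⟨ +-monoˡ-≤ (k ∸ 1) n≤c*k ⟩
  c * k + (k ∸ 1) <⟨ +-monoʳ-< (c * k) (≤-reflexive (sym (m+n≡1+m+[n∸1] 0 k))) ⟩
  c * k + k       ≡⟨ +-comm (c * k) k ⟩
  suc c * k       ∎))
  where open ≤-Reasoning

-- b lies in the arc [a + k, a + n − k]: a and b are at cyclic distance at least k modulo n.
Separated : ℕ → ℕ → ℕ → ℕ → Set
Separated n k a b = a + k ≤ b × b + k ≤ a + n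

separated-+ʳ : ∀ {n k a b} s → Separated n k a b → Separated n k (a + s) (b + s)
separated-+ʳ {n} {k} {a} {b} s (a+k≤b , b+k≤a+n) =
  subst (_≤ b + s) (sym (xy∙z≈xz∙y a s k)) (+-monoˡ-≤ s a+k≤b) ,
  subst₂ _≤_ (sym (xy∙z≈xz∙y b s k)) (xy∙z≈xz∙y a n s) (+-monoˡ-≤ s b+k≤a+n)

separated-/ : ∀ {n r a b} k .{{_ : NonZero k}} →
  Separated (n * k) (r * k) a b → Separated n r (a / k) (b / k)
separated-/ {n} {r} {a} {b} k (h₁ , h₂) =
  m+o*n≤p⇒m/n+o≤p/n r k h₁ ,
  subst₂ _≤_ ([m+o*n]/n≡m/n+o b r k) ([m+o*n]/n≡m/n+o a n k) (/-monoˡ-≤ k h₂)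

separated-+⇒ : ∀ {n k a t} → Separated n k a (a + t) → k ≤ t × t + k ≤ n
separated-+⇒ {n} {k} {a} {t} (a+k≤a+t , a+t+k≤a+n) =
  +-cancelˡ-≤ a k t a+k≤a+t , +-cancelˡ-≤ a (t + k) n (subst (_≤ a + n) (+-assoc a t k) a+t+k≤a+n)

separated⇒≤cdist : ∀ {n r a b} → Separated n r a b → r ≤ cdist n a b
separated⇒≤cdist {n} {r} {a} sep@(a+r≤b , _) with m≤n⇒∃[o]m+o≡n (m+n≤o⇒m≤o a a+r≤b)
... | t , refl with separated-+⇒ sep
... | r≤t , t+r≤n = subst (λ d → r ≤ d ⊓ (n ∸ d)) (sym (∣m-m+n∣≡n a t))
  (⊓-glb r≤t (subst (_≤ n ∸ t) (m+n∸m≡n t r) (∸-monoˡ-≤ t t+r≤n)))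

cdist-comm : ∀ n a b → cdist n a b ≡ cdist n b a
cdist-comm n a b rewrite ∣-∣-comm a b = refl

separated⇒%-apart : ∀ {n k a b} .{{_ : NonZero n}} .{{_ : NonZero k}} →
  Separated n k a b → a % n + k ≤ b % n ⊎ b % n + k ≤ a % n
separated⇒%-apart {n} {k} {a} sep@(a+k≤b , _) with m≤n⇒∃[o]m+o≡n (m+n≤o⇒m≤o a a+k≤b)
... | t , refl with separated-+⇒ sep
... | k≤t , t+k≤n = subst (λ β → α + k ≤ β ⊎ β + k ≤ α) (sym β≡[α+t]%n) (cases (α + t <? n))
  where
  α : ℕ
  α = a % n
  t<n : t < n
  t<n = <-≤-trans (m<m+n t (>-nonZero⁻¹ k)) t+k≤n
  β≡[α+t]%n : (a + t) % n ≡ (α + t) % n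
  β≡[α+t]%n = trans (%-distribˡ-+ a t n) (cong (λ s → (α + s) % n) (m<n⇒m%n≡m t<n))
  cases : Dec (α + t < n) → α + k ≤ (α + t) % n ⊎ (α + t) % n + k ≤ α
  cases (yes α+t<n) = inj₁ (subst (α + k ≤_) (sym (m<n⇒m%n≡m α+t<n)) (+-monoʳ-≤ α k≤t))
  cases (no α+t≮n) = inj₂ (subst (λ β → β + k ≤ α) (sym wrapped) (begin
    (α + t ∸ n) + k ≡⟨ +-∸-comm k n≤α+t ⟨
    (α + t + k) ∸ n ≤⟨ ∸-monoˡ-≤ n (subst (_≤ α + n) (sym (+-assoc α t k)) (+-monoʳ-≤ α t+k≤n)) ⟩
    (α + n) ∸ n     ≡⟨ m+n∸n≡m α n ⟩
    α               ∎))
    where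
    open ≤-Reasoning
    n≤α+t : n ≤ α + t
    n≤α+t = ≮⇒≥ α+t≮n
    wrapped : (α + t) % n ≡ α + t ∸ n
    wrapped = trans (sym (m≤n⇒[n∸m]%m≡n%m n≤α+t))
      (m<n⇒m%n≡m (m<n+o⇒m∸n<o (α + t) n (+-mono-< (m%n<n a n) t<n)))

separated⇒%/-distinct : ∀ {n k a b} .{{_ : NonZero n}} .{{_ : NonZero k}} →
  Separated n k a b → (a % n) / k ≢ (b % n) / k
separated⇒%/-distinct {n} {k} {a} {b} sep with separated⇒%-apart {n} {k} {a} {b} sep
... | inj₁ apart = <⇒≢ (m+n≤o⇒m/n<o/n k apart)
... | inj₂ apart = ≢-sym (<⇒≢ (m+n≤o⇒m/n<o/n k apart))

sum-<-pointwise : ∀ {k} (f g : Fin k → ℕ) → (∀ i → f i < g i) → sum f + k ≤ sum g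
sum-<-pointwise {zero} f g f<g = z≤n
sum-<-pointwise {suc k} f g f<g = begin
  (f zero + sum (f ∘ suc)) + suc k   ≡⟨ +-suc _ k ⟩
  suc ((f zero + sum (f ∘ suc)) + k) ≡⟨ cong suc (+-assoc (f zero) _ k) ⟩
  suc (f zero) + (sum (f ∘ suc) + k) ≤⟨ +-mono-≤ (f<g zero) (sum-<-pointwise (f ∘ suc) (g ∘ suc) (f<g ∘ suc)) ⟩
  g zero + sum (g ∘ suc)             ∎
  where open ≤-Reasoning

interlaceFrom⇒separated : ∀ {n k} (p q : Fin k → ℕ) → IsPolygon n k p → IsPolygon n k q →
  InterlaceFrom k p q → Separated n k (sum p) (sum q)
interlaceFrom⇒separated p q _ _ (p<q , _) .proj₁ = sum-<-pointwise p q p<q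
interlaceFrom⇒separated {n} {zero} p q _ _ _ .proj₂ = z≤n
interlaceFrom⇒separated {n} {suc k} p q poly-p poly-q (_ , q<next-p) .proj₂ = begin
  sum q + suc k                          ≡⟨ cong (_+ suc k) (sum-init-last q) ⟩
  (sum (q ∘ inject₁) + q-last) + suc k   ≡⟨ +-suc _ k ⟩
  suc ((sum (q ∘ inject₁) + q-last) + k) ≡⟨ cong suc (xy∙z≈xz∙y _ q-last k) ⟩
  suc ((sum (q ∘ inject₁) + k) + q-last) ≤⟨ +-mono-≤-< inner last<first+n ⟩
  sum (p ∘ suc) + (p zero + n)           ≡⟨ x∙yz≈yx∙z (sum (p ∘ suc)) (p zero) n ⟩
  sum p + n                              ∎
  where
  open ≤-Reasoning
  q-last : ℕ
  q-last = q (fromℕ k)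
  inner : sum (q ∘ inject₁) + k ≤ sum (p ∘ suc)
  inner = sum-<-pointwise _ _ (λ i → q<next-p (inject₁ i) (suc i) (cong suc (sym (toℕ-inject₁ i))))
  last<first+n : q-last < p zero + n
  last<first+n = +-mono-≤ (proj₁ (IsPolygon.inRange poly-p zero)) (proj₂ (IsPolygon.inRange poly-q (fromℕ k)))

sumColouring : ∀ n k r .{{_ : NonZero n}} .{{_ : NonZero k}} → ProperColouring n k r ⌈ n / k ⌉
sumColouring n k r = colour , proper
  where
  colour : (p : Fin k → ℕ) → IsVertex n k r p → Fin ⌈ n / k ⌉
  colour p _ = fromℕ< (m<n⇒m/k<⌈n/k⌉ k (m%n<n (sum p) n))
  distinct : ∀ p q → IsVertex n k r p → IsVertex n k r q → InterlaceFrom k p q →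
    (sum p % n) / k ≢ (sum q % n) / k
  distinct p q (poly-p , _) (poly-q , _) pq =
    separated⇒%/-distinct (interlaceFrom⇒separated p q poly-p poly-q pq)
  proper : ∀ p q (hp : IsVertex n k r p) (hq : IsVertex n k r q) →
    Interlace k p q → colour p hp ≢ colour q hq
  proper p q hp hq (inj₁ pq) eq = distinct p q hp hq pq (fromℕ<-injective _ _ _ _ eq)
  proper p q hp hq (inj₂ qp) eq = distinct q p hq hp qp (fromℕ<-injective _ _ _ _ (sym eq))

j+i*n+t≤j+i′*n : ∀ j n {i i′ t} → i < i′ → t ≤ n → (j + i * n) + t ≤ j + i′ * n
j+i*n+t≤j+i′*n j n {i} {i′} {t} i<i′ t≤n = begin
  (j + i * n) + t ≤⟨ +-monoʳ-≤ (j + i * n) t≤n ⟩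
  (j + i * n) + n ≡⟨ +-assoc j (i * n) n ⟩
  j + (i * n + n) ≡⟨ cong (j +_) (+-comm (i * n) n) ⟩
  j + suc i * n   ≤⟨ +-monoʳ-≤ j (*-monoˡ-≤ n i<i′) ⟩
  j + i′ * n      ∎
  where open ≤-Reasoning

regularPolygon : (n k : ℕ) .{{_ : NonZero k}} → ℕ → Fin k → ℕ
regularPolygon n k j i = suc ((j + toℕ i * n) / k)

module _ {n k : ℕ} .{{_ : NonZero k}} where

  regularPolygon-isPolygon : ∀ {j} → k ≤ n → j < n → IsPolygon n k (regularPolygon n k j)
  regularPolygon-isPolygon {j} k≤n j<n = record
    { inRange = λ i → s≤s z≤n , m<n*o⇒m/o<n (begin-strict
        j + toℕ i * n   <⟨ +-monoˡ-< (toℕ i * n) j<n ⟩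
        suc (toℕ i) * n ≤⟨ *-monoˡ-≤ n (toℕ<n i) ⟩
        k * n           ≡⟨ *-comm k n ⟩
        n * k           ∎)
    ; increasing = λ i i′ i<i′ → s≤s (m+n≤o⇒m/n<o/n k (j+i*n+t≤j+i′*n j n i<i′ k≤n))
    }
    where open ≤-Reasoning

  regularPolygon-≤cdist : ∀ {r j} → r * k ≤ n → ∀ i i′ → toℕ i < toℕ i′ →
    r ≤ cdist n (regularPolygon n k j i) (regularPolygon n k j i′)
  regularPolygon-≤cdist {r} {j} rk≤n i i′ i<i′ =
    separated⇒≤cdist (separated-/ k (j+i*n+t≤j+i′*n j n i<i′ rk≤n , wrap))
    where
    open ≤-Reasoning
    wrap : (j + toℕ i′ * n) + r * k ≤ (j + toℕ i * n) + n * k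
    wrap = begin
      (j + toℕ i′ * n) + r * k ≤⟨ j+i*n+t≤j+i′*n j n (toℕ<n i′) rk≤n ⟩
      j + k * n                ≡⟨ cong (j +_) (*-comm k n) ⟩
      j + n * k                ≤⟨ +-monoˡ-≤ (n * k) (m≤m+n j (toℕ i * n)) ⟩
      (j + toℕ i * n) + n * k  ∎

  regularPolygon-isStable : ∀ {r j} → r * k ≤ n → IsStable n k r (regularPolygon n k j)
  regularPolygon-isStable {r} {j} rk≤n i i′ i≢i′ with <-cmp (toℕ i) (toℕ i′)
  ... | tri< i<i′ _ _ = regularPolygon-≤cdist {j = j} rk≤n i i′ i<i′
  ... | tri≈ _ i≡i′ _ = ⊥-elim (i≢i′ (toℕ-injective i≡i′))
  ... | tri> _ _ i′<i = subst (r ≤_) (cdist-comm n (regularPolygon n k j i′) (regularPolygon n k j i))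
    (regularPolygon-≤cdist {j = j} rk≤n i′ i i′<i)

  regularPolygon-interlace : ∀ {j j′} → Separated n k j j′ →
    InterlaceFrom k (regularPolygon n k j) (regularPolygon n k j′)
  regularPolygon-interlace {j} {j′} sep =
    (λ i → s≤s (m+n≤o⇒m/n<o/n k (proj₁ (sep-at i)))) ,
    (λ i i′ i′≡1+i → s≤s (m+n≤o⇒m/n<o/n k (before-next i i′ i′≡1+i)))
    where
    sep-at : ∀ i → Separated n k (j + toℕ i * n) (j′ + toℕ i * n)
    sep-at i = separated-+ʳ (toℕ i * n) sep
    before-next : ∀ i i′ → toℕ i′ ≡ suc (toℕ i) → (j′ + toℕ i * n) + k ≤ j + toℕ i′ * n
    before-next i i′ i′≡1+i = begin
      (j′ + toℕ i * n) + k ≤⟨ proj₂ (sep-at i) ⟩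
      (j + toℕ i * n) + n  ≡⟨ +-assoc j (toℕ i * n) n ⟩
      j + (toℕ i * n + n)  ≡⟨ cong (j +_) (+-comm (toℕ i * n) n) ⟩
      j + suc (toℕ i) * n  ≡⟨ cong (λ m → j + m * n) (sym i′≡1+i) ⟩
      j + toℕ i′ * n       ∎
      where open ≤-Reasoning

firstIndexOf : ∀ {m c} → (Fin m → Fin c) → Fin c → ℕ
firstIndexOf {zero} g a = 0
firstIndexOf {suc m} g a with g zero ≟ a
... | yes _ = 0
... | no _ = suc (firstIndexOf (g ∘ suc) a)

firstIndexOf-≤ : ∀ {m c} (g : Fin m → Fin c) (y : Fin m) → firstIndexOf g (g y) ≤ toℕ y
firstIndexOf-≤ {suc m} g y with g zero ≟ g y
... | yes _ = z≤n
firstIndexOf-≤ {suc m} g zero | no g0≢g0 = ⊥-elim (g0≢g0 refl)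
firstIndexOf-≤ {suc m} g (suc y) | no _ = s≤s (firstIndexOf-≤ (g ∘ suc) y)

firstIndexOf-attained : ∀ {m c} (g : Fin m → Fin c) (y : Fin m) →
  Σ (Fin m) λ x → toℕ x ≡ firstIndexOf g (g y) × g x ≡ g y
firstIndexOf-attained {suc m} g y with g zero ≟ g y
... | yes g0≡gy = zero , refl , g0≡gy
firstIndexOf-attained {suc m} g zero | no g0≢g0 = ⊥-elim (g0≢g0 refl)
firstIndexOf-attained {suc m} g (suc y) | no _ with firstIndexOf-attained (g ∘ suc) y
... | x , x≡first , gx≡gy = suc x , cong suc x≡first , gx≡gy

IsCircularColouring : (n k c : ℕ) → (Fin n → Fin c) → Set
IsCircularColouring n k c g = ∀ u v → g u ≡ g v → ¬ Separated n k (toℕ u) (toℕ v)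

module _ {n k : ℕ} .{{_ : NonZero k}} (2k≤n : k + k ≤ n) where

  private
    k≤n : k ≤ n
    k≤n = m+n≤o⇒m≤o k 2k≤n

  -- Offsets d < n that are not separated from 0 lie in [0, k) ∪ [n − k, n); folding the second
  -- interval onto the first can identify two offsets only if they are separated.
  foldOffset : ∀ d → .(d < n) → Fin k
  foldOffset d d<n with d <? k
  ... | yes d<k = fromℕ< d<k
  ... | no _ = fromℕ< (m<n+o⇒m∸n<o d (n ∸ k) (subst (d <_) (sym (m∸n+n≡m k≤n)) d<n))

  n∸k≤offset : ∀ {d} → ¬ Separated n k 0 d → ¬ d < k → n ∸ k ≤ d
  n∸k≤offset {d} not-sep d≮k =
    m≤n+o⇒m∸n≤o n k (subst (n ≤_) (+-comm d k) (<⇒≤ (≰⇒> λ d+k≤n → not-sep (≮⇒≥ d≮k , d+k≤n))))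

  separated-folded : ∀ {d d′} → n ∸ k ≤ d′ → d ≡ d′ ∸ (n ∸ k) → Separated n k d d′
  separated-folded {d} {d′} n∸k≤d′ d≡ = (begin
      d + k       ≤⟨ +-monoʳ-≤ d k≤n∸k ⟩
      d + (n ∸ k) ≡⟨ d′≡ ⟨
      d′          ∎) , (begin
      d′ + k           ≡⟨ cong (_+ k) d′≡ ⟩
      d + (n ∸ k) + k  ≡⟨ +-assoc d (n ∸ k) k ⟩
      d + (n ∸ k + k)  ≡⟨ cong (d +_) (m∸n+n≡m k≤n) ⟩
      d + n            ∎)
    where
    open ≤-Reasoning
    k≤n∸k : k ≤ n ∸ k
    k≤n∸k = subst (_≤ n ∸ k) (m+n∸n≡m k k) (∸-monoˡ-≤ k 2k≤n)
    d′≡ : d′ ≡ d + (n ∸ k)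
    d′≡ = trans (sym (m∸n+n≡m n∸k≤d′)) (cong (_+ (n ∸ k)) (sym d≡))

  foldOffset-injective : ∀ d d′ .(d<n : d < n) .(d′<n : d′ < n) →
    ¬ Separated n k 0 d → ¬ Separated n k 0 d′ → ¬ Separated n k d d′ → ¬ Separated n k d′ d →
    foldOffset d d<n ≡ foldOffset d′ d′<n → d ≡ d′
  foldOffset-injective d d′ _ _ ns₀ ns₀′ ns ns′ eq with d <? k | d′ <? k
  ... | yes _ | yes _ = fromℕ<-injective d d′ _ _ eq
  ... | yes _ | no d′≮k =
    ⊥-elim (ns (separated-folded (n∸k≤offset ns₀′ d′≮k) (fromℕ<-injective _ _ _ _ eq)))
  ... | no d≮k | yes _ =
    ⊥-elim (ns′ (separated-folded (n∸k≤offset ns₀ d≮k) (fromℕ<-injective _ _ _ _ (sym eq))))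
  ... | no d≮k | no d′≮k = ∸-cancelʳ-≡ (n∸k≤offset ns₀ d≮k) (n∸k≤offset ns₀′ d′≮k)
    (fromℕ<-injective _ _ _ _ eq)

  -- Each colour class is described relative to its least element, so that the offsets of one class
  -- are pairwise non-separated and non-separated from 0.
  circularColouring⇒n≤c*k : ∀ {c} (g : Fin n → Fin c) → IsCircularColouring n k c g → n ≤ c * k
  circularColouring⇒n≤c*k {c} g proper = injective⇒≤ {f = encode} encode-injective
    where
    leader : Fin n → ℕ
    leader y = firstIndexOf g (g y)
    offset : Fin n → ℕ
    offset y = toℕ y ∸ leader y
    offset<n : ∀ y → offset y < n
    offset<n y = ≤-<-trans (m∸n≤m (toℕ y) (leader y)) (toℕ<n y)
    offset+leader : ∀ y → offset y + leader y ≡ toℕ y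
    offset+leader y = m∸n+n≡m (firstIndexOf-≤ g y)

    not-separated-from-0 : ∀ y → ¬ Separated n k 0 (offset y)
    not-separated-from-0 y sep with firstIndexOf-attained g y
    ... | x , x≡leader , gx≡gy =
      proper x y gx≡gy (subst₂ (Separated n k) (sym x≡leader) (offset+leader y) (separated-+ʳ (leader y) sep))

    not-separated : ∀ y z → g y ≡ g z → ¬ Separated n k (offset y) (offset z)
    not-separated y z gy≡gz sep = proper y z gy≡gz (subst₂ (Separated n k) (offset+leader y)
      (trans (cong (λ l → offset z + firstIndexOf g l) gy≡gz) (offset+leader z))
      (separated-+ʳ (leader y) sep))

    encode : Fin n → Fin (c * k)
    encode y = combine (g y) (foldOffset (offset y) (offset<n y))

    encode-injective : ∀ {y z} → encode y ≡ encode z → y ≡ z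
    encode-injective {y} {z} eq with combine-injective (g y) _ (g z) _ eq
    ... | gy≡gz , folds≡ = toℕ-injective (begin
      toℕ y               ≡⟨ offset+leader y ⟨
      offset y + leader y ≡⟨ cong₂ _+_ offsets≡ (cong (firstIndexOf g) gy≡gz) ⟩
      offset z + leader z ≡⟨ offset+leader z ⟩
      toℕ z               ∎)
      where
      open ≡-Reasoning
      offsets≡ : offset y ≡ offset z
      offsets≡ = foldOffset-injective (offset y) (offset z) (offset<n y) (offset<n z)
        (not-separated-from-0 y) (not-separated-from-0 z)
        (not-separated y z gy≡gz) (not-separated z y (sym gy≡gz)) folds≡

regularPolygonColouring : ∀ {n k r c} .{{_ : NonZero k}} → k ≤ n → r * k ≤ n →
  ProperColouring n k r c → Σ (Fin n → Fin c) (IsCircularColouring n k c)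
regularPolygonColouring {n} {k} {c = c} k≤n rk≤n (colour , proper) = g , λ u v gu≡gv sep →
  proper _ _ _ _ (inj₁ (regularPolygon-interlace sep)) gu≡gv
  where
  g : Fin n → Fin c
  g j = colour (regularPolygon n k (toℕ j))
    (regularPolygon-isPolygon k≤n (toℕ<n j) , regularPolygon-isStable rk≤n)

corollary2 : (n k r : ℕ) → .{{_ : NonZero k}} → 1 ≤ n → 2 ≤ r → r * k ≤ n →
    ChromaticNumberIs n k r ⌈ n / k ⌉
corollary2 zero k r () _ _
corollary2 n@(suc _) k r _ 2≤r rk≤n = sumColouring n k r , atLeast
  where
  2k≤rk : k + k ≤ r * k
  2k≤rk = subst (_≤ r * k) (cong (k +_) (+-identityʳ k)) (*-monoˡ-≤ k 2≤r)
  2k≤n : k + k ≤ n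
  2k≤n = ≤-trans 2k≤rk rk≤n
  atLeast : ∀ c → ProperColouring n k r c → ⌈ n / k ⌉ ≤ c
  atLeast c χ with regularPolygonColouring (m+n≤o⇒m≤o k 2k≤n) rk≤n χ
  ... | g , proper = n≤c*k⇒⌈n/k⌉≤c k (circularColouring⇒n≤c*k 2k≤n g proper)
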